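{- Let $(B,A\cup\{\alpha\})$ be an admissible order-domain such that $(B,A)$ is not matchable, and let $\mathsf{Match\_Ask}(B,A,\alpha)=(\hat B,\hat A,M)$. Then (i) for all asks $a,a'\in A\cup\{\alpha\}$ with $a\succ a'$ and $\mathsf{id}(a')\in\mathsf{ids_{ask}}(M)$, we have $\mathsf{Qty}(M,\mathsf{id}(a))=\mathsf{qty}(a)$; and (ii) for all bids $b,b'\in B$ with $b\succ b'$ and $\mathsf{id}(b')\in\mathsf{ids_{bid}}(M)$, we have $\mathsf{Qty}(M,\mathsf{id}(b))=\mathsf{qty}(b)$.
   Context: An order is a 4-tuple $\omega=(\mathsf{id}(\omega),\mathsf{timestamp}(\omega),\mathsf{qty}(\omega),\mathsf{price}(\omega))$ of natural numbers with $\mathsf{qty}(\omega)>0$. An order-domain $(B,A)$ is a pair of finite sets of orders (bids, asks); it is admissible if all orders in $B\cup A$ have pairwise distinct ids and pairwise distinct timestamps. Bid $b$ and ask $a$ are tradable if $\mathsf{price}(b)\ge\mathsf{price}(a)$; $(B,A)$ is matchable if some $b\in B,a\in A$ are tradable. Competitiveness: bid $b_1\succ b_2$ iff $\mathsf{price}(b_1)>\mathsf{price}(b_2)$, or prices equal and $\mathsf{timestamp}(b_1)<\mathsf{timestamp}(b_2)$; ask $a_1\succ a_2$ iff $\mathsf{price}(a_1)<\mathsf{price}(a_2)$, or prices equal and $\mathsf{timestamp}(a_1)<\mathsf{timestamp}(a_2)$. A transaction is a triple $(id_b,id_a,q)$ with $q>0$; for a set $M$ of transactions, $\mathsf{ids_{bid}}(M)$,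 $\mathsf{ids_{ask}}(M)$ are the sets of bid/ask ids occurring, and $\mathsf{Qty}(M,id)$ is the total quantity of transactions in $M$ whose bid id (for a bid) resp. ask id (for an ask) is $id$. $\mathsf{Match\_Ask}(B,A,\alpha)$: if $B=\emptyset$ return $(B,A\cup\{\alpha\},\emptyset)$. Otherwise let $\beta$ be the most competitive bid in $B$. If $\beta,\alpha$ not tradable, return $(B,A\cup\{\alpha\},\emptyset)$. If $\mathsf{qty}(\beta)=\mathsf{qty}(\alpha)$, return $(B\setminus\{\beta\},A,\{(\mathsf{id}(\beta),\mathsf{id}(\alpha),\mathsf{qty}(\alpha))\})$. If $\mathsf{qty}(\beta)>\mathsf{qty}(\alpha)$, return $((B\setminus\{\beta\})\cup\{\beta'\},A,\{(\mathsf{id}(\beta),\mathsf{id}(\alpha),\mathsf{qty}(\alpha))\})$, where $\beta'$ equals $\beta$ except $\mathsf{qty}(\beta')=\mathsf{qty}(\beta)-\mathsf{qty}(\alpha)$. If $\mathsf{qty}(\beta)<\mathsf{qty}(\alpha)$, let $\alpha'$ equal $\alpha$ except $\mathsf{qty}(\alpha')=\mathsf{qty}(\alpha)-\mathsf{qty}(\beta)$, compute $(B'',A'',M'')=\mathsf{Match\_Ask}(B\setminus\{\beta\},A,\alpha')$ and return $(B'',A'',M''\cup\{(\mathsf{id}(\beta),\mathsf{id}(\alpha),\mathsf{qty}(\beta))\})$. -}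

module Defs where

open import Data.Nat using (ℕ; zero; suc; _+_; _∸_; _≤_; _<_; _≟_; _<?_; _≤?_)
open import Data.Nat.Properties using (m<n⇒0<n∸m; ≮⇒≥; ≤∧≢⇒<)
open import Data.Nat.ListAction using (sum)
open import Relation.Binary.PropositionalEquality using (sym)
open import Data.List using (List; []; _∷_; _++_; map; filter; length)
open import Data.List.Membership.Propositional using (_∈_)
open import Data.Product using (_×_; _,_; Σ; ∃; proj₁; proj₂)
open import Data.Sum using (_⊎_; inj₁; inj₂)
open import Relation.Nullary using (¬_; Dec; yes; no; ¬?)
open import Relation.Nullary.Decidable using (_×-dec_; _⊎-dec_)
open import Relation.Binary.PropositionalEquality using (_≡_; refl; cong)

record Order : Set where
  constructor order
  field
    oid       : ℕ
    timestamp : ℕ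
    qty       : ℕ
    price     : ℕ
    .qty>0    : 0 < qty
open Order public

_≟ₒ_ : (o o' : Order) → Dec (o ≡ o')
order i t q p _ ≟ₒ order i' t' q' p' _ with i ≟ i' | t ≟ t' | q ≟ q' | p ≟ p'
... | yes refl | yes refl | yes refl | yes refl = yes refl
... | no ne | _ | _ | _ = no λ e → ne (cong oid e)
... | yes _ | no ne | _ | _ = no λ e → ne (cong timestamp e)
... | yes _ | yes _ | no ne | _ = no λ e → ne (cong qty e)
... | yes _ | yes _ | yes _ | no ne = no λ e → ne (cong price e)

-- Finite sets of orders are represented by lists (membership = _∈_).

Admissible : List Order → List Order → Set
Admissible B A = ∀ {o o'} → o ∈ B ++ A → o' ∈ B ++ A →
  (oid o ≡ oid o' → o ≡ o') × (timestamp o ≡ timestamp o' → o ≡ o')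

Tradable : Order → Order → Set
Tradable b a = price a ≤ price b

tradable? : (b a : Order) → Dec (Tradable b a)
tradable? b a = price a ≤? price b

Matchable : List Order → List Order → Set
Matchable B A = Σ Order λ b → Σ Order λ a → b ∈ B × a ∈ A × Tradable b a

_≻bid_ : Order → Order → Set
b₁ ≻bid b₂ = price b₂ < price b₁ ⊎ (price b₁ ≡ price b₂ × timestamp b₁ < timestamp b₂)

_≻ask_ : Order → Order → Set
a₁ ≻ask a₂ = price a₁ < price a₂ ⊎ (price a₁ ≡ price a₂ × timestamp a₁ < timestamp a₂)

_≻bid?_ : (b₁ b₂ : Order) → Dec (b₁ ≻bid b₂)
b₁ ≻bid? b₂ = (price b₂ <? price b₁) ⊎-dec ((price b₁ ≟ price b₂) ×-dec (timestamp b₁ <? timestamp b₂))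

bestBid : Order → List Order → Order
bestBid x [] = x
bestBid x (y ∷ ys) with y ≻bid? x
... | yes _ = bestBid y ys
... | no  _ = bestBid x ys

remove : Order → List Order → List Order
remove β = filter (λ o → ¬? (o ≟ₒ β))

Transaction : Set
Transaction = ℕ × ℕ × ℕ

bidId askId tqty : Transaction → ℕ
bidId (i , _ , _) = i
askId (_ , j , _) = j
tqty  (_ , _ , q) = q

idsBid idsAsk : List Transaction → List ℕ
idsBid = map bidId
idsAsk = map askId

QtyBid QtyAsk : List Transaction → ℕ → ℕ
QtyBid M i = sum (map tqty (filter (λ t → bidId t ≟ i) M))
QtyAsk M i = sum (map tqty (filter (λ t → askId t ≟ i) M))

-- Match_Ask.  The recursion removes the best bid from B each time, so it
-- is run with fuel  length B  (which is always sufficient).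

matchAskFuel : ℕ → List Order → List Order → Order →
               List Order × List Order × List Transaction
matchAskFuel _ [] A α = [] , α ∷ A , []
matchAskFuel zero B A α = B , α ∷ A , []   -- unreachable when fuel = length B
matchAskFuel (suc n) (x ∷ xs) A α with bestBid x xs
... | β with tradable? β α
...   | no _ = x ∷ xs , α ∷ A , []
...   | yes _ with qty β ≟ qty α | qty α <? qty β
...     | yes _ | _ = remove β (x ∷ xs) , A , (oid β , oid α , qty α) ∷ []
...     | no _ | yes lt =
            order (oid β) (timestamp β) (qty β ∸ qty α) (price β) (m<n⇒0<n∸m lt)
              ∷ remove β (x ∷ xs) , A , (oid β , oid α , qty α) ∷ []
...     | no ne | no nlt with matchAskFuel n (remove β (x ∷ xs)) A
                                (order (oid α) (timestamp α) (qty α ∸ qty β) (price α) (m<n⇒0<n∸m (≤∧≢⇒< (≮⇒≥ nlt) ne)))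
...       | (B'' , A'' , M'') = B'' , A'' , (oid β , oid α , qty β) ∷ M''

matchAsk : List Order → List Order → Order → List Order × List Order × List Transaction
matchAsk B A α = matchAskFuel (length B) B A α

{-# OPTIONS --safe #-}
-- Matching α consumes bids strictly in order of competitiveness: each round trades with
-- the best remaining bid β and recurses (on B ∖ {β}) only once β is exhausted. So if b'
-- trades and b ≻ b', then b was one of these β's and was filled completely, and since ids
-- are unique no later transaction mentions it. On the ask side only α ever trades, so
-- a' = α; an ask a ≻ α in A would then be tradable with the bid α met, contradicting that
-- (B , A) is not matchable.
module Submission where

open import Defs
open import Data.Empty using (⊥-elim)
open import Data.List using (List; []; _∷_; map; length)
open import Data.List.Membership.Propositional using (_∈_)
open import Data.List.Membership.Propositional.Properties using (∈-filter⁺; ∈-filter⁻; ∈-map⁻; ∈-++⁺ˡ; ∈-++⁺ʳ)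
open import Data.List.Properties using (filter-accept; filter-reject; filter-none)
open import Data.List.Relation.Unary.All as All using (All; []; _∷_)
open import Data.List.Relation.Unary.Any using (here; there)
open import Data.Nat using (ℕ; zero; suc; _+_; _≤_; _<_; _≟_; _<?_)
open import Data.Nat.ListAction using (sum)
open import Data.Nat.Properties using (<-cmp; ≮⇒≥; <⇒≤; <-trans; ≤-trans; ≤-refl; ≤-reflexive; <-irrefl; <⇒≱; +-identityʳ)
open import Data.Product using (Σ; _×_; _,_; proj₁; proj₂)
open import Data.Sum using (inj₁; inj₂)
open import Relation.Binary using (tri<; tri≈; tri>)
open import Relation.Nullary using (¬_; ¬?; yes; no)
open import Relation.Binary.PropositionalEquality using (_≡_; _≢_; refl; sym; trans; cong; subst; module ≡-Reasoning)

transactions : ℕ → List Order → List Order → Order → List Transaction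
transactions n B A α = proj₂ (proj₂ (matchAskFuel n B A α))

data MatchAskStep (n : ℕ) (B A : List Order) (α β : Order) : List Transaction → Set where
  unmatched : MatchAskStep n B A α β []
  filled    : Tradable β α → ∀ q → MatchAskStep n B A α β ((oid β , oid α , q) ∷ [])
  continued : Tradable β α → (α' : Order) → oid α' ≡ oid α → price α' ≡ price α →
              MatchAskStep n B A α β ((oid β , oid α , qty β) ∷ transactions n (remove β B) A α')

matchAsk-step : ∀ n x xs A α →
                MatchAskStep n (x ∷ xs) A α (bestBid x xs) (transactions (suc n) (x ∷ xs) A α)
matchAsk-step n x xs A α with bestBid x xs
... | β with tradable? β α
...   | no _ = unmatched
...   | yes tr with qty β ≟ qty α | qty α <? qty β
...     | yes _ | _      = filled tr (qty α)
...     | no _  | yes _  = filled tr (qty α)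
...     | no _  | no _   = continued tr _ refl refl

data _⪰bid_ (b₁ b₂ : Order) : Set where
  higher-price : price b₂ < price b₁ → b₁ ⪰bid b₂
  same-price   : price b₁ ≡ price b₂ → timestamp b₁ ≤ timestamp b₂ → b₁ ⪰bid b₂

⪰bid-refl : ∀ b → b ⪰bid b
⪰bid-refl b = same-price refl ≤-refl

⪰bid-trans : ∀ {b₁ b₂ b₃} → b₁ ⪰bid b₂ → b₂ ⪰bid b₃ → b₁ ⪰bid b₃
⪰bid-trans (higher-price p₂<p₁) (higher-price p₃<p₂) = higher-price (<-trans p₃<p₂ p₂<p₁)
⪰bid-trans {b₁} (higher-price p₂<p₁) (same-price p₂≡p₃ _) = higher-price (subst (_< price b₁) p₂≡p₃ p₂<p₁)
⪰bid-trans {b₃ = b₃} (same-price p₁≡p₂ _) (higher-price p₃<p₂) = higher-price (subst (price b₃ <_) (sym p₁≡p₂) p₃<p₂)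
⪰bid-trans (same-price p₁≡p₂ t₁≤t₂) (same-price p₂≡p₃ t₂≤t₃) = same-price (trans p₁≡p₂ p₂≡p₃) (≤-trans t₁≤t₂ t₂≤t₃)

≻bid⇒⪰bid : ∀ {b₁ b₂} → b₁ ≻bid b₂ → b₁ ⪰bid b₂
≻bid⇒⪰bid (inj₁ p₂<p₁)           = higher-price p₂<p₁
≻bid⇒⪰bid (inj₂ (p₁≡p₂ , t₁<t₂)) = same-price p₁≡p₂ (<⇒≤ t₁<t₂)

⊁bid⇒⪰bid : ∀ {b₁ b₂} → ¬ (b₂ ≻bid b₁) → b₁ ⪰bid b₂
⊁bid⇒⪰bid {b₁} {b₂} b₂⊁b₁ with <-cmp (price b₂) (price b₁)
... | tri< p₂<p₁ _ _ = higher-price p₂<p₁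
... | tri≈ _ p₂≡p₁ _ = same-price (sym p₂≡p₁) (≮⇒≥ λ t₂<t₁ → b₂⊁b₁ (inj₂ (p₂≡p₁ , t₂<t₁)))
... | tri> _ _ p₁<p₂ = ⊥-elim (b₂⊁b₁ (inj₁ p₁<p₂))

≻bid⇒⋡bid : ∀ {b₁ b₂} → b₁ ≻bid b₂ → ¬ (b₂ ⪰bid b₁)
≻bid⇒⋡bid (inj₁ p₂<p₁)       (higher-price p₁<p₂) = <-irrefl refl (<-trans p₂<p₁ p₁<p₂)
≻bid⇒⋡bid (inj₁ p₂<p₁)       (same-price p₂≡p₁ _) = <-irrefl p₂≡p₁ p₂<p₁
≻bid⇒⋡bid (inj₂ (p₁≡p₂ , _)) (higher-price p₁<p₂) = <-irrefl p₁≡p₂ p₁<p₂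
≻bid⇒⋡bid (inj₂ (_ , t₁<t₂)) (same-price _ t₂≤t₁) = <⇒≱ t₁<t₂ t₂≤t₁

bestBid-∈ : ∀ x xs → bestBid x xs ∈ x ∷ xs
bestBid-∈ x [] = here refl
bestBid-∈ x (y ∷ ys) with y ≻bid? x
... | yes _ = there (bestBid-∈ y ys)
... | no _ with bestBid-∈ x ys
...   | here β≡x = here β≡x
...   | there β∈ys = there (there β∈ys)

bestBid-⪰ : ∀ x xs {b} → b ∈ x ∷ xs → bestBid x xs ⪰bid b
bestBid-⪰ x [] (here refl) = ⪰bid-refl x
bestBid-⪰ x (y ∷ ys) b∈ with y ≻bid? x
bestBid-⪰ x (y ∷ ys) (here refl)        | yes y≻x = ⪰bid-trans (bestBid-⪰ y ys (here refl)) (≻bid⇒⪰bid y≻x)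
bestBid-⪰ x (y ∷ ys) (there b∈)         | yes _   = bestBid-⪰ y ys b∈
bestBid-⪰ x (y ∷ ys) (here refl)        | no _    = bestBid-⪰ x ys (here refl)
bestBid-⪰ x (y ∷ ys) (there (here refl)) | no y⊁x = ⪰bid-trans (bestBid-⪰ x ys (here refl)) (⊁bid⇒⪰bid y⊁x)
bestBid-⪰ x (y ∷ ys) (there (there b∈)) | no _    = bestBid-⪰ x ys (there b∈)

∈-remove⁻ : ∀ {o β B} → o ∈ remove β B → o ∈ B × o ≢ β
∈-remove⁻ {β = β} = ∈-filter⁻ (λ o → ¬? (o ≟ₒ β))

∈-remove⁺ : ∀ {o β B} → o ∈ B → o ≢ β → o ∈ remove β B
∈-remove⁺ {β = β} = ∈-filter⁺ (λ o → ¬? (o ≟ₒ β))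

UniqueIds : List Order → Set
UniqueIds B = ∀ {o o'} → o ∈ B → o' ∈ B → oid o ≡ oid o' → o ≡ o'

UniqueIds-remove : ∀ {β B} → UniqueIds B → UniqueIds (remove β B)
UniqueIds-remove unique o∈ o'∈ = unique (proj₁ (∈-remove⁻ o∈)) (proj₁ (∈-remove⁻ o'∈))

record Fill (B : List Order) (α : Order) (t : Transaction) : Set where
  field
    bid      : Order
    bid∈B    : bid ∈ B
    bidId≡   : bidId t ≡ oid bid
    askId≡   : askId t ≡ oid α
    tradable : Tradable bid α
open Fill

Fill-remainder : ∀ {β B α α' t} → oid α' ≡ oid α → price α' ≡ price α →
                 Fill (remove β B) α' t → Fill B α t
Fill-remainder oid≡ price≡ f = record
  { bid      = bid f
  ; bid∈B    = proj₁ (∈-remove⁻ (bid∈B f))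
  ; bidId≡   = bidId≡ f
  ; askId≡   = trans (askId≡ f) oid≡
  ; tradable = subst (_≤ price (bid f)) price≡ (tradable f)
  }

transactions-fill : ∀ n B A α → All (Fill B α) (transactions n B A α)
transactions-fill n [] A α = []
transactions-fill zero (x ∷ xs) A α = []
transactions-fill (suc n) (x ∷ xs) A α = by-step (matchAsk-step n x xs A α)
  where
  β = bestBid x xs

  fill-β : Tradable β α → ∀ q → Fill (x ∷ xs) α (oid β , oid α , q)
  fill-β tr _ = record { bid = β ; bid∈B = bestBid-∈ x xs ; bidId≡ = refl ; askId≡ = refl ; tradable = tr }

  by-step : ∀ {M} → MatchAskStep n (x ∷ xs) A α β M → All (Fill (x ∷ xs) α) M
  by-step unmatched                        = []
  by-step (filled tr q)                    = fill-β tr q ∷ []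
  by-step (continued tr α' oid≡ price≡) =
    fill-β tr (qty β) ∷ All.map (Fill-remainder oid≡ price≡) (transactions-fill n (remove β (x ∷ xs)) A α')

QtyBid-∷-≡ : ∀ i j q M → QtyBid ((i , j , q) ∷ M) i ≡ q + QtyBid M i
QtyBid-∷-≡ i j q M = cong (λ l → sum (map tqty l)) (filter-accept (λ t → bidId t ≟ i) {xs = M} refl)

QtyBid-∷-≢ : ∀ {i k} j q M → i ≢ k → QtyBid ((i , j , q) ∷ M) k ≡ QtyBid M k
QtyBid-∷-≢ {k = k} j q M i≢k = cong (λ l → sum (map tqty l)) (filter-reject (λ t → bidId t ≟ k) {xs = M} i≢k)

QtyBid-absent : ∀ M k → All (λ t → bidId t ≢ k) M → QtyBid M k ≡ 0
QtyBid-absent M k absent = cong (λ l → sum (map tqty l)) (filter-none (λ t → bidId t ≟ k) absent)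

more-competitive-bid-filled :
  ∀ n B A α → UniqueIds B → ∀ {b b'} → b ∈ B → b' ∈ B → b ≻bid b' →
  oid b' ∈ idsBid (transactions n B A α) → QtyBid (transactions n B A α) (oid b) ≡ qty b
more-competitive-bid-filled n [] A α unique () b'∈ b≻b' traded
more-competitive-bid-filled zero (x ∷ xs) A α unique b∈ b'∈ b≻b' ()
more-competitive-bid-filled (suc n) (x ∷ xs) A α unique {b} {b'} b∈ b'∈ b≻b' traded =
  by-step (matchAsk-step n x xs A α) traded
  where
  β = bestBid x xs

  b'≢β : b' ≢ β
  b'≢β refl = ≻bid⇒⋡bid b≻b' (bestBid-⪰ x xs b∈)

  oid-b'≢oid-β : oid b' ≢ oid β
  oid-b'≢oid-β e = b'≢β (unique b'∈ (bestBid-∈ x xs) e)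

  remainder : Order → List Transaction
  remainder α' = transactions n (remove β (x ∷ xs)) A α'

  β-filled : ∀ α' → QtyBid ((oid β , oid α , qty β) ∷ remainder α') (oid β) ≡ qty β
  β-filled α' = begin
    QtyBid ((oid β , oid α , qty β) ∷ rest) (oid β) ≡⟨ QtyBid-∷-≡ (oid β) (oid α) (qty β) rest ⟩
    qty β + QtyBid rest (oid β)                     ≡⟨ cong (qty β +_) (QtyBid-absent rest (oid β) β-absent) ⟩
    qty β + 0                                       ≡⟨ +-identityʳ (qty β) ⟩
    qty β                                           ∎
    where
    open ≡-Reasoning
    rest = remainder α'
    β-absent : All (λ t → bidId t ≢ oid β) rest
    β-absent = All.map (λ f e → let (bid∈ , bid≢β) = ∈-remove⁻ (bid∈B f)
                                in bid≢β (unique bid∈ (bestBid-∈ x xs) (trans (sym (bidId≡ f)) e)))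
                       (transactions-fill n (remove β (x ∷ xs)) A α')

  by-step : ∀ {M} → MatchAskStep n (x ∷ xs) A α β M → oid b' ∈ idsBid M → QtyBid M (oid b) ≡ qty b
  by-step (filled _ _)         (here e)        = ⊥-elim (oid-b'≢oid-β e)
  by-step (continued _ _ _ _)  (here e)        = ⊥-elim (oid-b'≢oid-β e)
  by-step (continued _ α' _ _) (there traded') with b ≟ₒ β
  ... | yes b≡β = subst (λ o → QtyBid ((oid β , oid α , qty β) ∷ remainder α') (oid o) ≡ qty o)
                        (sym b≡β) (β-filled α')
  ... | no b≢β  = trans (QtyBid-∷-≢ (oid α) (qty β) _ λ e → b≢β (unique b∈ (bestBid-∈ x xs) (sym e)))
                        (more-competitive-bid-filled n (remove β (x ∷ xs)) A α' (UniqueIds-remove unique)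
                           (∈-remove⁺ b∈ b≢β) (∈-remove⁺ b'∈ b'≢β) b≻b' traded')

traded-ask : ∀ n B A α {k} → k ∈ idsAsk (transactions n B A α) →
             k ≡ oid α × Σ Order λ b → b ∈ B × Tradable b α
traded-ask n B A α traded with ∈-map⁻ askId traded
... | t , t∈ , k≡askId = let f = All.lookup (transactions-fill n B A α) t∈
                         in trans k≡askId (askId≡ f) , bid f , bid∈B f , tradable f

≻ask-irrefl : ∀ {a} → ¬ (a ≻ask a)
≻ask-irrefl (inj₁ p<p)       = <-irrefl refl p<p
≻ask-irrefl (inj₂ (_ , t<t)) = <-irrefl refl t<t

≻ask⇒price≤ : ∀ {a₁ a₂} → a₁ ≻ask a₂ → price a₁ ≤ price a₂
≻ask⇒price≤ (inj₁ p₁<p₂)      = <⇒≤ p₁<p₂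
≻ask⇒price≤ (inj₂ (p₁≡p₂ , _)) = ≤-reflexive p₁≡p₂

≻ask-tradable⇒matchable : ∀ {B A a α b} → a ∈ A → a ≻ask α → b ∈ B → Tradable b α → Matchable B A
≻ask-tradable⇒matchable {a = a} {α} {b} a∈ a≻α b∈ tr = b , a , b∈ , a∈ , ≤-trans (≻ask⇒price≤ {a} {α} a≻α) tr

lemmaA2 : (B A : List Order) (α : Order) →
          Admissible B (α ∷ A) → ¬ Matchable B A →
          (B̂ Â : List Order) (M : List Transaction) →
          matchAsk B A α ≡ (B̂ , Â , M) →
          (∀ a a' → a ∈ α ∷ A → a' ∈ α ∷ A → a ≻ask a' →
             oid a' ∈ idsAsk M → QtyAsk M (oid a) ≡ qty a)
          ×
          (∀ b b' → b ∈ B → b' ∈ B → b ≻bid b' →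
             oid b' ∈ idsBid M → QtyBid M (oid b) ≡ qty b)
lemmaA2 B A α admissible unmatchable B̂ Â M matched
  rewrite sym (cong (λ r → proj₂ (proj₂ r)) matched) = asks , bids
  where
  M₀ : List Transaction
  M₀ = transactions (length B) B A α

  bids : ∀ b b' → b ∈ B → b' ∈ B → b ≻bid b' → oid b' ∈ idsBid M₀ → QtyBid M₀ (oid b) ≡ qty b
  bids b b' = more-competitive-bid-filled (length B) B A α
                (λ o∈ o'∈ → proj₁ (admissible (∈-++⁺ˡ o∈) (∈-++⁺ˡ o'∈)))

  asks : ∀ a a' → a ∈ α ∷ A → a' ∈ α ∷ A → a ≻ask a' → oid a' ∈ idsAsk M₀ → QtyAsk M₀ (oid a) ≡ qty a
  asks a a' a∈ a'∈ a≻a' traded with traded-ask (length B) B A α traded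
  ... | oid-a'≡oid-α , b , b∈ , tradable-bα
    with proj₁ (admissible (∈-++⁺ʳ B a'∈) (∈-++⁺ʳ B (here refl))) oid-a'≡oid-α
  ... | refl with a∈
  ...   | here refl = ⊥-elim (≻ask-irrefl {a} a≻a')
  ...   | there a∈A = ⊥-elim (unmatchable (≻ask-tradable⇒matchable {α = α} a∈A a≻a' b∈ tradable-bα))
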